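{- A squarefree positive integer $n$ is $\varphi$-practical if and only if it is weakly $\varphi$-practical.
   Context: $\varphi$ denotes Euler's totient function. A positive integer $n$ is $\varphi$-practical if every integer $m$ with $1\le m\le n$ can be written as $m=\sum_{d\in\mathcal D}\varphi(d)$ for some subset $\mathcal D$ of the positive divisors of $n$. Write $n=p_1^{e_1}\cdots p_k^{e_k}$ with primes $p_1<\cdots<p_k$ and $e_i\ge1$, and set $m_i=p_1^{e_1}\cdots p_i^{e_i}$ for $i=0,\dots,k-1$ (so $m_0=1$). The integer $n$ is weakly $\varphi$-practical if $p_{i+1}\le m_i+2$ for every $i=0,\dots,k-1$. -}

module Defs where

open import Data.Nat using (ℕ; zero; suc; _+_; _*_; _^_; _≤_; _<_)
open import Data.Nat.Properties using (_<?_)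
open import Data.Nat.Divisibility using (_∣_; _∣?_)
open import Data.Nat.Coprimality using (Coprime; coprime?)
open import Data.Nat.Primality using (Prime; prime?)
open import Data.List using (List; filter; length; map; upTo)
open import Data.Nat.ListAction using (sum; product)
open import Data.List.Relation.Binary.Sublist.Propositional using (_⊆_)
open import Data.Product using (Σ; _×_)
open import Relation.Nullary using (¬_)
open import Relation.Nullary.Decidable using (_×-dec_)
open import Relation.Binary.PropositionalEquality using (_≡_)

range1 : ℕ → List ℕ
range1 n = map suc (upTo n)

φ : ℕ → ℕ
φ d = length (filter (λ k → coprime? k d) (range1 d))

divisors : ℕ → List ℕ
divisors n = filter (λ d → d ∣? n) (range1 n)

-- n is φ-practical: every m with 1 ≤ m ≤ n is Σ_{d∈D} φ(d) for some
-- subset D of the positive divisors of n (subsets = sublists of the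
-- duplicate-free list of divisors)
φPractical : ℕ → Set
φPractical n = ∀ m → 1 ≤ m → m ≤ n →
  Σ (List ℕ) (λ D → D ⊆ divisors n × sum (map φ D) ≡ m)

-- p-adic valuation of n ≥ 1 (for p ≥ 2): #{ e ∈ [1,n] : p^e ∣ n }
val : ℕ → ℕ → ℕ
val p n = length (filter (λ e → (p ^ e) ∣? n) (range1 n))

-- for a prime p ∣ n, m(p) = ∏_{q prime, q ∣ n, q < p} q^{v_q(n)};
-- for p = p_{i+1} this is m_i = p_1^{e_1} ⋯ p_i^{e_i}  (m_0 = 1)
partBelow : ℕ → ℕ → ℕ
partBelow n p =
  product (map (λ q → q ^ val q n)
               (filter (λ q → prime? q ×-dec (q ∣? n)) (upTo p)))

-- weakly φ-practical: p_{i+1} ≤ m_i + 2 for each i = 0..k-1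
weaklyφPractical : ℕ → Set
weaklyφPractical n = ∀ p → Prime p → p ∣ n → p ≤ partBelow n p + 2

Squarefree : ℕ → Set
Squarefree n = ∀ p → Prime p → ¬ (p * p ∣ n)

module Submission where

-- Write radBelow n N for the product of the prime factors of n below N.  For
-- squarefree n this is the m_i of the statement (partBelow n p_{i+1}); it is
-- built up one prime at a time (induction principle radBelow-ind) and equals n
-- for N > n.  Two facts about φ are derived from its counting definition and
-- from splitting divisor sums over p m (p prime, p ∤ m) into d and p d, d ∣ m:
--   * φ(p d) = (p - 1) φ(d) for a prime p ∤ d,
--   * Σ_{d ∣ m} φ(d) = m for every m = radBelow n N (Gauss' identity).
--
-- (⇐) If every t ≤ m is a φ-sum over divisors of m and p ≤ m + 2, then every
--     t ≤ p m is a + (p - 1) b with a, b ≤ m, hence a φ-sum over divisors of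
--     p m; induction along radBelow n reaches n.
-- (⇒) If p > m + 2 for m = radBelow n p, then m + 1 is not a φ-sum over
--     divisors of n: a divisor with a prime factor q ≥ p has φ ≥ q - 1 > m + 1,
--     and the other divisors divide m, whose φ-values add up to only m.

open import Defs
open import Data.Nat using (ℕ; _≤_)
open import Data.Product using (_×_)

open import Data.Nat.Base using (zero; suc; _+_; _*_; _^_; _∸_; _<_; pred; z≤n; s≤s; s≤s⁻¹; >-nonZero; nonTrivial⇒n>1)
open import Data.Nat.Properties
open import Data.Nat.Divisibility
open import Data.Nat.DivMod using (_/_; m*n/n≡m)
open import Data.Nat.Coprimality using (Coprime; coprime?; coprime-divisor; 1-coprimeTo) renaming (sym to coprime-sym)
open import Data.Nat.Primality using (Prime; prime?; euclidsLemma; prime⇒irreducible; prime⇒nonTrivial; prime⇒nonZero; prime[2])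
open import Data.Nat.Primality.Factorisation using (factorise)
open import Data.Nat.ListAction using (sum; product)
open import Data.Nat.ListAction.Properties using (sum-++; product-++)
open import Data.List using ([]; _∷_; _++_; filter; length; map; upTo; [_])
open import Data.List.Properties using (upTo-∷ʳ; map-++; map-cong)
open import Data.List.Relation.Unary.All as All using (All; []; _∷_)
open import Data.List.Relation.Unary.All.Properties using (all-filter)
open import Data.List.Relation.Binary.Sublist.Propositional using (_⊆_; []; _∷ʳ_; _∷_)
open import Data.List.Relation.Binary.Sublist.Propositional.Properties using (filter-⊆; All-resp-⊆)
open import Function using (_∘_)
open import Data.Bool using (Bool; true; false; if_then_else_)
open import Data.Product using (Σ; _,_)
open import Data.Sum using (_⊎_; inj₁; inj₂)
open import Relation.Nullary using (Dec; yes; no; does; ¬_; contradiction)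
open import Relation.Nullary.Decidable using (_×-dec_)
open import Relation.Nullary.Decidable.Core using (T?)
open import Relation.Unary using (Decidable)
open import Relation.Binary.PropositionalEquality hiding ([_])
open import Algebra.Properties.CommutativeSemigroup +-commutativeSemigroup using () renaming (interchange to +-interchange)

if-yes : ∀ {a b} {P : Set a} {B : Set b} (e : Dec P) {x y : B} → P → (if does e then x else y) ≡ x
if-yes (yes _) _ = refl
if-yes (no ¬p) p = contradiction p ¬p

if-no : ∀ {a b} {P : Set a} {B : Set b} (e : Dec P) {x y : B} → ¬ P → (if does e then x else y) ≡ y
if-no (yes p) ¬p = contradiction p ¬p
if-no (no _) _ = refl

if-iff : ∀ {a b c} {P : Set a} {Q : Set b} {B : Set c} (d : Dec P) (e : Dec Q) {x y : B} →
         (P → Q) → (Q → P) → (if does d then x else y) ≡ (if does e then x else y)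
if-iff (yes p) (yes q) f g = refl
if-iff (yes p) (no ¬q) f g = contradiction (f p) ¬q
if-iff (no ¬p) (yes q) f g = contradiction (g q) ¬p
if-iff (no ¬p) (no ¬q) f g = refl

[_]·_ : ∀ {a} {P : Set a} → Dec P → ℕ → ℕ
[ d ]· x = if does d then x else 0

[]·-scale : ∀ {a} {P : Set a} (d : Dec P) k x → [ d ]· (k * x) ≡ k * ([ d ]· x)
[]·-scale (yes _) k x = refl
[]·-scale (no _) k x = sym (*-zeroʳ k)

[]·-cong : ∀ {a} {P : Set a} (d : Dec P) {x y} → (P → x ≡ y) → [ d ]· x ≡ [ d ]· y
[]·-cong (yes p) x≡y = x≡y p
[]·-cong (no _) _ = refl

[]·-+ : ∀ {a} {P : Set a} (d : Dec P) x y → [ d ]· x + [ d ]· y ≡ [ d ]· (x + y)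
[]·-+ (yes _) x y = refl
[]·-+ (no _) x y = refl

-- Finite sums g 1 + ⋯ + g N

sumTo : (ℕ → ℕ) → ℕ → ℕ
sumTo g zero = 0
sumTo g (suc N) = sumTo g N + g (suc N)

sumTo-cong : ∀ {g h} N → (∀ k → 1 ≤ k → k ≤ N → g k ≡ h k) → sumTo g N ≡ sumTo h N
sumTo-cong zero eq = refl
sumTo-cong (suc N) eq =
  cong₂ _+_ (sumTo-cong N (λ k 1≤k k≤N → eq k 1≤k (m≤n⇒m≤1+n k≤N))) (eq (suc N) (s≤s z≤n) ≤-refl)

sumTo-zero : ∀ {g} N → (∀ k → 1 ≤ k → k ≤ N → g k ≡ 0) → sumTo g N ≡ 0
sumTo-zero zero eq = refl
sumTo-zero (suc N) eq =
  cong₂ _+_ (sumTo-zero N (λ k 1≤k k≤N → eq k 1≤k (m≤n⇒m≤1+n k≤N))) (eq (suc N) (s≤s z≤n) ≤-refl)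

sumTo-split : ∀ g A B → sumTo g (A + B) ≡ sumTo g A + sumTo (λ k → g (A + k)) B
sumTo-split g A zero rewrite +-identityʳ A = sym (+-identityʳ _)
sumTo-split g A (suc B) rewrite +-suc A B =
  trans (cong (_+ g (suc (A + B))) (sumTo-split g A B)) (+-assoc (sumTo g A) _ _)

sumTo-+ : ∀ f g N → sumTo (λ k → f k + g k) N ≡ sumTo f N + sumTo g N
sumTo-+ f g zero = refl
sumTo-+ f g (suc N) rewrite sumTo-+ f g N =
  +-interchange (sumTo f N) (sumTo g N) (f (suc N)) (g (suc N))

sumTo-scale : ∀ c g N → sumTo (λ k → c * g k) N ≡ c * sumTo g N
sumTo-scale c g zero = sym (*-zeroʳ c)
sumTo-scale c g (suc N) rewrite sumTo-scale c g N = sym (*-distribˡ-+ c (sumTo g N) (g (suc N)))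

sumTo-trunc : ∀ {g} M N → M ≤ N → (∀ k → M < k → g k ≡ 0) → sumTo g N ≡ sumTo g M
sumTo-trunc {g} M N M≤N vanish = begin
  sumTo g N                                        ≡⟨ cong (sumTo g) (sym (m+[n∸m]≡n M≤N)) ⟩
  sumTo g (M + (N ∸ M))                            ≡⟨ sumTo-split g M (N ∸ M) ⟩
  sumTo g M + sumTo (λ k → g (M + k)) (N ∸ M)      ≡⟨ cong (sumTo g M +_) (sumTo-zero (N ∸ M) (λ k 1≤k _ → vanish (M + k) (m<m+n M 1≤k))) ⟩
  sumTo g M + 0                                    ≡⟨ +-identityʳ _ ⟩
  sumTo g M ∎
  where open ≡-Reasoning

sumTo-periodic : ∀ g d → (∀ k → g (d + k) ≡ g k) → ∀ j → sumTo g (j * d) ≡ j * sumTo g d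
sumTo-periodic g d per zero = refl
sumTo-periodic g d per (suc j) = begin
  sumTo g (d + j * d)                            ≡⟨ sumTo-split g d (j * d) ⟩
  sumTo g d + sumTo (λ k → g (d + k)) (j * d)    ≡⟨ cong (sumTo g d +_) (sumTo-cong (j * d) (λ k _ _ → per k)) ⟩
  sumTo g d + sumTo g (j * d)                    ≡⟨ cong (sumTo g d +_) (sumTo-periodic g d per j) ⟩
  sumTo g d + j * sumTo g d ∎
  where open ≡-Reasoning

sumTo-multiples : ∀ p' (h : ℕ → ℕ) M →
  sumTo (λ k → [ suc p' ∣? k ]· h k) (M * suc p') ≡ sumTo (λ e → h (e * suc p')) M
sumTo-multiples p' h zero = refl
sumTo-multiples p' h (suc M) = begin
  sumTo g (p + M * p)                              ≡⟨ sumTo-split g p (M * p) ⟩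
  sumTo g p + sumTo (λ k → g (p + k)) (M * p)      ≡⟨ cong₂ _+_ one-block shifted ⟩
  h (1 * p) + sumTo (λ e → h (suc e * p)) M        ≡⟨ sym (sumTo-split (λ e → h (e * p)) 1 M) ⟩
  sumTo (λ e → h (e * p)) (suc M) ∎
  where
  open ≡-Reasoning
  p = suc p'
  g = λ k → [ p ∣? k ]· h k
  -- in [1, p] only p itself is a multiple of p
  one-block : sumTo g p ≡ h (1 * p)
  one-block = cong₂ _+_
    (sumTo-zero p' (λ k 1≤k k≤p' → if-no (p ∣? k)
       (λ p∣k → <⇒≱ (s≤s k≤p') (∣⇒≤ {{>-nonZero 1≤k}} p∣k))))
    (trans (if-yes (p ∣? p) ∣-refl) (cong h (sym (+-identityʳ p))))
  shifted : sumTo (λ k → g (p + k)) (M * p) ≡ sumTo (λ e → h (suc e * p)) M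
  shifted = trans
    (sumTo-cong (M * p) (λ k _ _ → if-iff (p ∣? (p + k)) (p ∣? k)
       (λ p∣p+k → ∣m+n∣m⇒∣n p∣p+k ∣-refl) (∣m∣n⇒∣m+n ∣-refl)))
    (sumTo-multiples p' (λ k → h (p + k)) M)

divSum : (ℕ → ℕ) → ℕ → ℕ
divSum f n = sumTo (λ d → [ d ∣? n ]· f d) n

sum-filter : ∀ {p} {P : ℕ → Set p} (P? : Decidable P) (f : ℕ → ℕ) xs →
  sum (map f (filter P? xs)) ≡ sum (map (λ x → [ P? x ]· f x) xs)
sum-filter P? f [] = refl
sum-filter P? f (x ∷ xs) with P? x
... | yes _ = cong (f x +_) (sum-filter P? f xs)
... | no _ = sum-filter P? f xs

length-filter : ∀ {p} {P : ℕ → Set p} (P? : Decidable P) xs →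
  length (filter P? xs) ≡ sum (map (λ x → [ P? x ]· 1) xs)
length-filter P? [] = refl
length-filter P? (x ∷ xs) with P? x
... | yes _ = cong suc (length-filter P? xs)
... | no _ = length-filter P? xs

sum-range1 : ∀ g N → sum (map g (range1 N)) ≡ sumTo g N
sum-range1 g zero = refl
sum-range1 g (suc N) = begin
  sum (map g (map suc (upTo (suc N))))            ≡⟨ cong (λ xs → sum (map g (map suc xs))) (sym (upTo-∷ʳ N)) ⟩
  sum (map g (map suc (upTo N ++ [ N ])))         ≡⟨ cong (sum ∘ map g) (map-++ suc (upTo N) [ N ]) ⟩
  sum (map g (range1 N ++ [ suc N ]))             ≡⟨ cong sum (map-++ g (range1 N) [ suc N ]) ⟩
  sum (map g (range1 N) ++ [ g (suc N) ])         ≡⟨ sum-++ (map g (range1 N)) [ g (suc N) ] ⟩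
  sum (map g (range1 N)) + (g (suc N) + 0)        ≡⟨ cong₂ _+_ (sum-range1 g N) (+-identityʳ _) ⟩
  sumTo g N + g (suc N) ∎
  where open ≡-Reasoning

divisors-sum : ∀ f n → sum (map f (divisors n)) ≡ divSum f n
divisors-sum f n = trans (sum-filter (λ d → d ∣? n) f (range1 n)) (sum-range1 _ n)

φ-count : ∀ d → φ d ≡ sumTo (λ k → [ coprime? k d ]· 1) d
φ-count d = trans (length-filter (λ k → coprime? k d) (range1 d)) (sum-range1 _ d)

-- 1 is coprime to every d ≥ 1
φ-pos : ∀ d → 1 ≤ d → 1 ≤ φ d
φ-pos (suc d) _ = begin
  1                                         ≡⟨ sym (if-yes (coprime? 1 (suc d)) (1-coprimeTo (suc d))) ⟩
  sumTo c 1                                 ≤⟨ m≤m+n _ _ ⟩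
  sumTo c 1 + sumTo (λ k → c (1 + k)) d     ≡⟨ sym (sumTo-split c 1 d) ⟩
  sumTo c (suc d)                           ≡⟨ sym (φ-count (suc d)) ⟩
  φ (suc d) ∎
  where
  open ≤-Reasoning
  c = λ k → [ coprime? k (suc d) ]· 1

prime≥2 : ∀ {p} → Prime p → 2 ≤ p
prime≥2 {p} pr = nonTrivial⇒n>1 p {{prime⇒nonTrivial pr}}

prime∤1 : ∀ {p} → Prime p → ¬ p ∣ 1
prime∤1 pr p∣1 = <⇒≢ (prime≥2 pr) (sym (∣1⇒≡1 p∣1))

prime-coprime : ∀ {p k} → Prime p → ¬ p ∣ k → Coprime p k
prime-coprime pr ¬p∣k {d} (d∣p , d∣k) with prime⇒irreducible pr d∣p
... | inj₁ d≡1 = d≡1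
... | inj₂ refl = contradiction d∣k ¬p∣k

prime-free-divisor : ∀ {p i o} → Prime p → ¬ p ∣ i → i ∣ p * o → i ∣ o
prime-free-divisor pr ¬p∣i = coprime-divisor (coprime-sym (prime-coprime pr ¬p∣i))

coprime-*-∣ : ∀ {a b m} → Coprime a b → a ∣ m → b ∣ m → a * b ∣ m
coprime-*-∣ {a} {b} c (divides q refl) b∣qa with coprime-divisor (coprime-sym c) (subst (b ∣_) (*-comm q a) b∣qa)
... | divides r refl = divides r (begin
  r * b * a   ≡⟨ *-assoc r b a ⟩
  r * (b * a) ≡⟨ cong (r *_) (*-comm b a) ⟩
  r * (a * b) ∎)
  where open ≡-Reasoning

prime-factor : ∀ n → 2 ≤ n → Σ ℕ λ p → Prime p × p ∣ n
prime-factor (suc zero) (s≤s ())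
prime-factor n@(suc (suc _)) _ with factorise n
... | record { factors = [] ; isFactorisation = () }
... | record { factors = p ∷ ps ; isFactorisation = eq ; factorsPrime = pr ∷ _ } =
  p , pr , subst (p ∣_) (sym eq) (m∣m*n (product ps))

-- squarefree numbers are positive (4 ∣ 0), and divisors of squarefree numbers are squarefree
sqf-nonzero : ∀ {n} → Squarefree n → 1 ≤ n
sqf-nonzero {zero} sf = contradiction ((2 * 2) ∣0) (sf 2 prime[2])
sqf-nonzero {suc n} sf = s≤s z≤n

sqf-∣ : ∀ {n d} → Squarefree n → d ∣ n → Squarefree d
sqf-∣ sf d∣n p pr pp∣d = sf p pr (∣-trans pp∣d d∣n)

sqf-cofactor : ∀ {q m} → Squarefree (q * m) → Prime q → ¬ q ∣ m
sqf-cofactor {q} sf pr q∣m = sf q pr (*-monoʳ-∣ q q∣m)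

-- Counting k ∈ [1, p d] coprime to d in two ways: there are p φ(d) of them
-- (coprimality to d has period d), and they are either coprime to p d
-- (when p ∤ k) or of the form k = e p with e ∈ [1, d] coprime to d.
φ-mult : ∀ {p d} → Prime p → ¬ p ∣ d → φ d + φ (p * d) ≡ p * φ d
φ-mult {zero} pr _ = contradiction (prime≥2 pr) λ ()
φ-mult {suc p'} {d} pr ¬p∣d = begin
  φ d + φ (p * d)                   ≡⟨ +-comm (φ d) (φ (p * d)) ⟩
  φ (p * d) + φ d                   ≡⟨ cong₂ _+_ (φ-count (p * d)) (trans (φ-count d) (sym multiples-of-p)) ⟩
  sumTo a (p * d) + sumTo b (p * d) ≡⟨ sym (sumTo-+ a b (p * d)) ⟩
  sumTo (λ k → a k + b k) (p * d)   ≡⟨ sumTo-cong (p * d) (λ k _ _ → split k) ⟩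
  sumTo c (p * d)                   ≡⟨ sumTo-periodic c d shift p ⟩
  p * sumTo c d                     ≡⟨ cong (p *_) (sym (φ-count d)) ⟩
  p * φ d ∎
  where
  open ≡-Reasoning
  p = suc p'
  c = λ k → [ coprime? k d ]· 1
  a = λ k → [ coprime? k (p * d) ]· 1
  b = λ k → [ p ∣? k ]· c k
  shift : ∀ k → c (d + k) ≡ c k
  shift k = if-iff (coprime? (d + k) d) (coprime? k d)
    (λ cop (e∣k , e∣d) → cop (∣m∣n⇒∣m+n e∣d e∣k , e∣d))
    (λ cop (e∣d+k , e∣d) → cop (∣m+n∣m⇒∣n e∣d+k e∣d , e∣d))
  -- k is coprime to d iff it is coprime to p d, or a multiple of p coprime to d
  split : ∀ k → a k + b k ≡ c k
  split k with p ∣? k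
  ... | yes p∣k = cong₂ _+_ (if-no (coprime? k (p * d))
                    (λ cop → <⇒≢ (prime≥2 pr) (sym (cop (p∣k , m∣m*n d)))))
                  (if-yes (p ∣? k) p∣k)
  ... | no ¬p∣k = begin
    a k + b k ≡⟨ cong (a k +_) (if-no (p ∣? k) ¬p∣k) ⟩
    a k + 0   ≡⟨ +-identityʳ (a k) ⟩
    a k       ≡⟨ if-iff (coprime? k (p * d)) (coprime? k d)
                   (λ cop (e∣k , e∣d) → cop (e∣k , ∣n⇒∣m*n p e∣d))
                   (λ cop {e} (e∣k , e∣pd) → cop (e∣k , prime-free-divisor pr (λ p∣e → ¬p∣k (∣-trans p∣e e∣k)) e∣pd)) ⟩
    c k ∎
  multiples-of-p : sumTo b (p * d) ≡ sumTo c d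
  multiples-of-p = trans (cong (sumTo b) (*-comm p d)) (trans (sumTo-multiples p' c d)
    (sumTo-cong d (λ e _ _ → if-iff (coprime? (e * p) d) (coprime? e d)
      (λ cop {f} (f∣e , f∣d) → cop (∣m⇒∣m*n p f∣e , f∣d))
      (λ cop {f} (f∣ep , f∣d) → cop (prime-free-divisor pr (λ p∣f → ¬p∣d (∣-trans p∣f f∣d))
                                        (subst (f ∣_) (*-comm e p) f∣ep) , f∣d)))))

φ-prime-mult : ∀ {k d} → Prime (suc k) → ¬ suc k ∣ d → φ (suc k * d) ≡ k * φ d
φ-prime-mult {k} {d} pr ¬p∣d = +-cancelˡ-≡ (φ d) _ _ (φ-mult pr ¬p∣d)

divSum-split : ∀ {p m} → Prime p → ¬ p ∣ m → 1 ≤ m → ∀ (f : ℕ → ℕ) →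
  divSum f (p * m) ≡ divSum f m + divSum (λ d → f (p * d)) m
divSum-split {zero} pr _ _ _ = contradiction (prime≥2 pr) λ ()
divSum-split {suc p'} {m} pr ¬p∣m 1≤m f = begin
  sumTo F (p * m)                         ≡⟨ sumTo-cong (p * m) (λ k _ _ → split k) ⟩
  sumTo (λ k → F₁ k + F₂ k) (p * m)       ≡⟨ sumTo-+ F₁ F₂ (p * m) ⟩
  sumTo F₁ (p * m) + sumTo F₂ (p * m)     ≡⟨ cong₂ _+_ multiples-of-p non-multiples ⟩
  divSum (λ d → f (p * d)) m + divSum f m ≡⟨ +-comm (divSum (λ d → f (p * d)) m) _ ⟩
  divSum f m + divSum (λ d → f (p * d)) m ∎
  where
  open ≡-Reasoning
  p = suc p'
  F = λ d → [ d ∣? p * m ]· f d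
  F₁ = λ d → [ p ∣? d ]· F d
  F₂ = λ d → [ d ∣? m ]· f d
  -- a divisor of p m either is a multiple of p, or is prime to p and divides m
  split : ∀ d → F d ≡ F₁ d + F₂ d
  split d with p ∣? d
  ... | yes p∣d = sym (trans (cong₂ _+_ (if-yes (p ∣? d) p∣d)
                    (if-no (d ∣? m) (λ d∣m → ¬p∣m (∣-trans p∣d d∣m)))) (+-identityʳ (F d)))
  ... | no ¬p∣d = sym (cong₂ _+_ (if-no (p ∣? d) ¬p∣d)
                    (if-iff (d ∣? m) (d ∣? p * m) (∣n⇒∣m*n p) (prime-free-divisor pr ¬p∣d)))
  multiples-of-p : sumTo F₁ (p * m) ≡ divSum (λ d → f (p * d)) m
  multiples-of-p = trans (cong (sumTo F₁) (*-comm p m)) (trans (sumTo-multiples p' F m)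
    (sumTo-cong m (λ e _ _ → trans
      (if-iff (e * p ∣? p * m) (e ∣? m)
         (λ ep∣pm → *-cancelʳ-∣ p (subst (e * p ∣_) (*-comm p m) ep∣pm))
         (λ e∣m → subst (e * p ∣_) (*-comm m p) (*-monoˡ-∣ p e∣m)))
      (cong ([ e ∣? m ]·_) (cong f (*-comm e p))))))
  non-multiples : sumTo F₂ (p * m) ≡ divSum f m
  non-multiples = sumTo-trunc m (p * m) (m≤n*m m p)
    (λ k m<k → if-no (k ∣? m) (λ k∣m → <⇒≱ m<k (∣⇒≤ {{>-nonZero 1≤m}} k∣m)))

primeFactor : ℕ → ℕ → ℕ
primeFactor n k = if does (prime? k ×-dec k ∣? n) then k else 1

-- the product of the prime factors of n below N; for p = p_{i+1} this is
-- m_i when n is squarefree (partBelow≡radBelow)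
radBelow : ℕ → ℕ → ℕ
radBelow n zero = 1
radBelow n (suc N) = primeFactor n N * radBelow n N

radBelow-ind : ∀ n (P : ℕ → Set) → P 1 →
  (∀ p → Prime p → p ∣ n → P (radBelow n p) → P (p * radBelow n p)) →
  ∀ N → P (radBelow n N)
radBelow-ind n P base step zero = base
radBelow-ind n P base step (suc N) = extend (prime? N ×-dec N ∣? n)
  where
  ih = radBelow-ind n P base step N
  extend : (e : Dec (Prime N × N ∣ n)) → P ((if does e then N else 1) * radBelow n N)
  extend (yes (pr , N∣n)) = step N pr N∣n ih
  extend (no _) = subst P (sym (*-identityˡ (radBelow n N))) ih

radBelow-pos : ∀ n N → 1 ≤ radBelow n N
radBelow-pos n = radBelow-ind n (1 ≤_) ≤-refl
  (λ p pr _ 1≤r → *-mono-≤ (≤-trans (s≤s z≤n) (prime≥2 pr)) 1≤r)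

radBelow-primes : ∀ {q} n N → Prime q → q ∣ radBelow n N → q < N
radBelow-primes n zero prq q∣1 = contradiction q∣1 (prime∤1 prq)
radBelow-primes {q} n (suc N) prq q∣ with euclidsLemma (primeFactor n N) (radBelow n N) prq q∣
... | inj₂ q∣r = m<n⇒m<1+n (radBelow-primes n N prq q∣r)
... | inj₁ q∣f = s≤s (bound (prime? N ×-dec N ∣? n) q∣f)
  where
  bound : (e : Dec (Prime N × N ∣ n)) → q ∣ (if does e then N else 1) → q ≤ N
  bound (yes (prN , _)) q∣N = ∣⇒≤ {{prime⇒nonZero prN}} q∣N
  bound (no _) q∣1 = contradiction q∣1 (prime∤1 prq)

radBelow-coprime : ∀ {p} n → Prime p → ¬ p ∣ radBelow n p
radBelow-coprime n pr p∣r = <-irrefl refl (radBelow-primes n _ pr p∣r)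

radBelow-∣ : ∀ n N → radBelow n N ∣ n
radBelow-∣ n = radBelow-ind n (_∣ n) (1∣ n)
  (λ p pr p∣n r∣n → coprime-*-∣ (prime-coprime pr (radBelow-coprime n pr)) p∣n r∣n)

HasPrimeFactor≥ : ℕ → ℕ → Set
HasPrimeFactor≥ N d = Σ ℕ λ q → Prime q × q ∣ d × N ≤ q

smooth-or-large : ∀ {n} N d → Squarefree d → d ∣ n → d ∣ radBelow n N ⊎ HasPrimeFactor≥ N d
smooth-or-large zero zero sf _ = contradiction (sqf-nonzero sf) λ ()
smooth-or-large zero (suc zero) _ _ = inj₁ ∣-refl
smooth-or-large zero d@(suc (suc _)) _ _ with prime-factor d (s≤s (s≤s z≤n))
... | q , prq , q∣d = inj₂ (q , prq , q∣d , z≤n)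
smooth-or-large {n} (suc N) d sf d∣n with prime? N ×-dec N ∣? d
... | yes (prN , divides d' refl) with smooth-or-large N d' (sqf-∣ sf d'∣d) (∣-trans d'∣d d∣n)
  where d'∣d = ∣m⇒∣m*n N ∣-refl
...   | inj₁ d'∣r = inj₁ (subst (λ x → d' * N ∣ x * radBelow n N) (sym N-factor)
                     (subst (_∣ N * radBelow n N) (*-comm N d') (*-monoʳ-∣ N d'∣r)))
  where
  N-factor : primeFactor n N ≡ N
  N-factor = if-yes (prime? N ×-dec N ∣? n) (prN , ∣-trans (n∣m*n d') d∣n)
...   | inj₂ (q , prq , q∣d' , N≤q) = inj₂ (q , prq , ∣m⇒∣m*n N q∣d' , ≤∧≢⇒< N≤q N≢q)
  where
  N≢q : N ≢ q
  N≢q refl = sqf-cofactor (subst Squarefree (*-comm d' N) sf) prN q∣d'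
smooth-or-large {n} (suc N) d sf d∣n | no ¬N-factor with smooth-or-large N d sf d∣n
... | inj₁ d∣r = inj₁ (∣n⇒∣m*n (primeFactor n N) d∣r)
... | inj₂ (q , prq , q∣d , N≤q) = inj₂ (q , prq , q∣d , ≤∧≢⇒< N≤q N≢q)
  where
  N≢q : N ≢ q
  N≢q refl = ¬N-factor (prq , q∣d)

radBelow-all : ∀ {n} → Squarefree n → radBelow n (suc n) ≡ n
radBelow-all {n} sf with smooth-or-large (suc n) n sf ∣-refl
... | inj₁ n∣r = ∣-antisym (radBelow-∣ n (suc n)) n∣r
... | inj₂ (q , _ , q∣n , n<q) = contradiction (∣⇒≤ {{>-nonZero (sqf-nonzero sf)}} q∣n) (<⇒≱ n<q)

val-prime-factor : ∀ {n q} → Squarefree n → Prime q → q ∣ n → val q n ≡ 1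
val-prime-factor {zero} sf _ _ = contradiction (sqf-nonzero sf) λ ()
val-prime-factor {n@(suc n')} {q} sf prq q∣n = begin
  val q n                                    ≡⟨ length-filter (λ e → (q ^ e) ∣? n) (range1 n) ⟩
  sum (map g (range1 n))                     ≡⟨ sum-range1 g n ⟩
  sumTo g (1 + n')                           ≡⟨ sumTo-split g 1 n' ⟩
  g 1 + sumTo (λ e → g (suc e)) n'           ≡⟨ cong₂ _+_ q¹∣n (sumTo-zero n' q²∤n) ⟩
  1 ∎
  where
  open ≡-Reasoning
  g = λ e → [ (q ^ e) ∣? n ]· 1
  q¹∣n : g 1 ≡ 1
  q¹∣n = if-yes ((q ^ 1) ∣? n) (subst (_∣ n) (sym (^-identityʳ q)) q∣n)
  q²∤n : ∀ k → 1 ≤ k → k ≤ n' → g (suc k) ≡ 0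
  q²∤n (suc k) _ _ = if-no ((q ^ suc (suc k)) ∣? n)
    (λ qᵏ⁺²∣n → sf q prq (∣-trans (*-monoʳ-∣ q (m∣m*n (q ^ k))) qᵏ⁺²∣n))

product-filter : ∀ {p} {P : ℕ → Set p} (P? : Decidable P) (f : ℕ → ℕ) xs →
  product (map f (filter P? xs)) ≡ product (map (λ x → if does (P? x) then f x else 1) xs)
product-filter P? f [] = refl
product-filter P? f (x ∷ xs) with P? x
... | yes _ = cong (f x *_) (product-filter P? f xs)
... | no _ = trans (product-filter P? f xs) (sym (+-identityʳ _))

product-primeFactors : ∀ n N → product (map (primeFactor n) (upTo N)) ≡ radBelow n N
product-primeFactors n zero = refl
product-primeFactors n (suc N) = begin
  product (map f (upTo (suc N)))          ≡⟨ cong (product ∘ map f) (sym (upTo-∷ʳ N)) ⟩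
  product (map f (upTo N ++ [ N ]))       ≡⟨ cong product (map-++ f (upTo N) [ N ]) ⟩
  product (map f (upTo N) ++ [ f N ])     ≡⟨ product-++ (map f (upTo N)) [ f N ] ⟩
  product (map f (upTo N)) * (f N * 1)    ≡⟨ cong₂ _*_ (product-primeFactors n N) (*-identityʳ (f N)) ⟩
  radBelow n N * f N                      ≡⟨ *-comm (radBelow n N) (f N) ⟩
  f N * radBelow n N ∎
  where
  open ≡-Reasoning
  f = primeFactor n

partBelow≡radBelow : ∀ {n} → Squarefree n → ∀ p → partBelow n p ≡ radBelow n p
partBelow≡radBelow {n} sf p = begin
  partBelow n p
    ≡⟨ product-filter P? (λ q → q ^ val q n) (upTo p) ⟩
  product (map (λ q → if does (P? q) then q ^ val q n else 1) (upTo p))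
    ≡⟨ cong product (map-cong exponent-one (upTo p)) ⟩
  product (map (primeFactor n) (upTo p))
    ≡⟨ product-primeFactors n p ⟩
  radBelow n p ∎
  where
  open ≡-Reasoning
  P? = λ q → prime? q ×-dec q ∣? n
  exponent-one : ∀ q → (if does (P? q) then q ^ val q n else 1) ≡ primeFactor n q
  exponent-one q = on-decision (P? q)
    where
    on-decision : (e : Dec (Prime q × q ∣ n)) → (if does e then q ^ val q n else 1) ≡ (if does e then q else 1)
    on-decision (yes (prq , q∣n)) = trans (cong (q ^_) (val-prime-factor sf prq q∣n)) (^-identityʳ q)
    on-decision (no _) = refl

-- Gauss' identity Σ_{d ∣ m} φ(d) = m, for products m of distinct primes

gauss-step : ∀ {p m} → Prime p → ¬ p ∣ m → 1 ≤ m → divSum φ m ≡ m → divSum φ (p * m) ≡ p * m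
gauss-step {p} {m} pr ¬p∣m 1≤m ih = begin
  divSum φ (p * m)                                          ≡⟨ divSum-split pr ¬p∣m 1≤m φ ⟩
  divSum φ m + divSum (λ d → φ (p * d)) m                   ≡⟨ sym (sumTo-+ _ _ m) ⟩
  sumTo (λ d → [ d ∣? m ]· φ d + [ d ∣? m ]· φ (p * d)) m   ≡⟨ sumTo-cong m (λ d _ _ → pointwise d) ⟩
  sumTo (λ d → p * ([ d ∣? m ]· φ d)) m                     ≡⟨ sumTo-scale p _ m ⟩
  p * divSum φ m                                            ≡⟨ cong (p *_) ih ⟩
  p * m ∎
  where
  open ≡-Reasoning
  pointwise : ∀ d → [ d ∣? m ]· φ d + [ d ∣? m ]· φ (p * d) ≡ p * ([ d ∣? m ]· φ d)
  pointwise d = begin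
    [ d ∣? m ]· φ d + [ d ∣? m ]· φ (p * d) ≡⟨ []·-+ (d ∣? m) (φ d) (φ (p * d)) ⟩
    [ d ∣? m ]· (φ d + φ (p * d))          ≡⟨ []·-cong (d ∣? m) (λ d∣m → φ-mult pr (λ p∣d → ¬p∣m (∣-trans p∣d d∣m))) ⟩
    [ d ∣? m ]· (p * φ d)                  ≡⟨ []·-scale (d ∣? m) p (φ d) ⟩
    p * ([ d ∣? m ]· φ d) ∎

gauss : ∀ n N → divSum φ (radBelow n N) ≡ radBelow n N
gauss n = radBelow-ind n (λ m → divSum φ m ≡ m) refl
  (λ p pr _ ih → gauss-step pr (radBelow-coprime n pr) (radBelow-pos n p) ih)

-- Weakly φ-practical ⇒ φ-practical

cover : ∀ {m k} → k ≤ suc m → ∀ b t → t ≤ m + k * b →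
  Σ ℕ λ a → Σ ℕ λ c → a ≤ m × c ≤ b × t ≡ a + k * c
cover {m} {k} k≤1+m zero t t≤ = t , 0 , subst (t ≤_) (no-blocks m) t≤ , z≤n , sym (no-blocks t)
  where
  no-blocks : ∀ x → x + k * 0 ≡ x
  no-blocks x = trans (cong (x +_) (*-zeroʳ k)) (+-identityʳ x)
cover {m} {k} k≤1+m (suc b) t t≤ with t ≤? m + k * b
... | yes t≤′ with cover k≤1+m b t t≤′
...   | a , c , a≤m , c≤b , eq = a , c , a≤m , m≤n⇒m≤1+n c≤b , eq
cover {m} {k} k≤1+m (suc b) t t≤ | no t≰ =
  t ∸ k * suc b , suc b , m≤n+o⇒m∸n≤o t (k * suc b) (subst (t ≤_) (+-comm m _) t≤) , ≤-refl ,
  sym (m∸n+n≡m k[b+1]≤t)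
  where
  k[b+1]≤t : k * suc b ≤ t
  k[b+1]≤t = begin
    k * suc b     ≡⟨ *-suc k b ⟩
    k + k * b     ≤⟨ +-monoˡ-≤ (k * b) k≤1+m ⟩
    suc m + k * b ≤⟨ ≰⇒> t≰ ⟩
    t ∎
    where open ≤-Reasoning

selected : (ℕ → Bool) → ℕ → ℕ
selected S d = [ T? (S d) ]· φ d

AllφSums : ℕ → Set
AllφSums n = ∀ t → t ≤ n → Σ (ℕ → Bool) λ S → divSum (selected S) n ≡ t

-- the divisor 1 has φ(1) = 1, giving the sums 0 and 1
allφSums-1 : AllφSums 1
allφSums-1 zero _ = (λ _ → false) , refl
allφSums-1 (suc zero) _ = (λ _ → true) , refl
allφSums-1 (suc (suc _)) (s≤s ())

-- from m to p m: write t = a + (p - 1) b with a, b ≤ m (cover), select the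
-- divisors d ∣ m giving a, and the p d with d ∣ m giving (p - 1) b
allφSums-step : ∀ {p m} → Prime p → ¬ p ∣ m → 1 ≤ m → p ≤ m + 2 → AllφSums m → AllφSums (p * m)
allφSums-step {zero} pr = contradiction (prime≥2 pr) λ ()
allφSums-step {suc k} {m} pr ¬p∣m 1≤m p≤m+2 sums t t≤pm
  with cover {m} {k} (s≤s⁻¹ (subst (suc k ≤_) (+-comm m 2) p≤m+2)) m t t≤pm
... | a , b , a≤m , b≤m , t≡a+kb with sums a a≤m | sums b b≤m
... | S₁ , sum₁ | S₂ , sum₂ = S , (begin
  divSum (selected S) (p * m)                                           ≡⟨ divSum-split pr ¬p∣m 1≤m (selected S) ⟩
  divSum (selected S) m + divSum (λ d → selected S (p * d)) m           ≡⟨ cong₂ _+_ (sumTo-cong m (λ d _ _ → coprime-part d))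
                                                                                      (sumTo-cong m (λ d _ _ → multiple-part d)) ⟩
  divSum (selected S₁) m + sumTo (λ d → k * ([ d ∣? m ]· selected S₂ d)) m ≡⟨ cong₂ _+_ sum₁ (trans (sumTo-scale k _ m) (cong (k *_) sum₂)) ⟩
  a + k * b                                                             ≡⟨ sym t≡a+kb ⟩
  t ∎)
  where
  open ≡-Reasoning
  p = suc k
  S : ℕ → Bool
  S d = if does (p ∣? d) then S₂ (d / p) else S₁ d
  coprime-part : ∀ d → [ d ∣? m ]· selected S d ≡ [ d ∣? m ]· selected S₁ d
  coprime-part d = []·-cong (d ∣? m) (λ d∣m →
    cong (λ s → [ T? s ]· φ d) (if-no (p ∣? d) (λ p∣d → ¬p∣m (∣-trans p∣d d∣m))))
  multiple-part : ∀ d → [ d ∣? m ]· selected S (p * d) ≡ k * ([ d ∣? m ]· selected S₂ d)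
  multiple-part d = trans ([]·-cong (d ∣? m) (λ d∣m → begin
    [ T? (S (p * d)) ]· φ (p * d) ≡⟨ cong₂ (λ s x → [ T? s ]· x) S[pd]≡S₂d (φ-prime-mult pr (λ p∣d → ¬p∣m (∣-trans p∣d d∣m))) ⟩
    [ T? (S₂ d) ]· (k * φ d)      ≡⟨ []·-scale (T? (S₂ d)) k (φ d) ⟩
    k * selected S₂ d ∎)) ([]·-scale (d ∣? m) k (selected S₂ d))
    where
    S[pd]≡S₂d : S (p * d) ≡ S₂ d
    S[pd]≡S₂d = trans (if-yes (p ∣? (p * d)) (m∣m*n d)) (cong S₂ (trans (cong (_/ p) (*-comm p d)) (m*n/n≡m d p)))

allφSums-radBelow : ∀ {n} → Squarefree n → weaklyφPractical n → ∀ N → AllφSums (radBelow n N)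
allφSums-radBelow {n} sf weak = radBelow-ind n AllφSums allφSums-1
  (λ p pr p∣n sums → allφSums-step pr (radBelow-coprime n pr) (radBelow-pos n p)
     (subst (λ x → p ≤ x + 2) (partBelow≡radBelow sf p) (weak p pr p∣n)) sums)

-- weakly φ-practical ⇒ φ-practical: n = radBelow n (1 + n), and a selection
-- S of divisors is the sublist of divisors n that it keeps
backward : ∀ {n} → Squarefree n → weaklyφPractical n → φPractical n
backward {n} sf weak t _ t≤n with allφSums-radBelow sf weak (suc n) t (subst (t ≤_) (sym (radBelow-all sf)) t≤n)
... | S , sumS = filter (T? ∘ S) (divisors n) , filter-⊆ (T? ∘ S) (divisors n) , (begin
  sum (map φ (filter (T? ∘ S) (divisors n))) ≡⟨ sum-filter (T? ∘ S) φ (divisors n) ⟩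
  sum (map (selected S) (divisors n))        ≡⟨ divisors-sum (selected S) n ⟩
  divSum (selected S) n                      ≡⟨ subst (λ x → divSum (selected S) x ≡ t) (radBelow-all sf) sumS ⟩
  t ∎)
  where open ≡-Reasoning

-- φ-practical ⇒ weakly φ-practical

summand-≤ : ∀ (f : ℕ → ℕ) xs → All (λ x → f x ≤ sum (map f xs)) xs
summand-≤ f [] = []
summand-≤ f (x ∷ xs) = m≤m+n (f x) _ ∷ All.map (λ h → ≤-trans h (m≤n+m _ (f x))) (summand-≤ f xs)

sublist-sum-≤ : ∀ {p} {P : ℕ → Set p} (P? : Decidable P) (f : ℕ → ℕ) {D xs} → D ⊆ xs → All P D →
  sum (map f D) ≤ sum (map (λ x → [ P? x ]· f x) xs)
sublist-sum-≤ P? f [] [] = z≤n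
sublist-sum-≤ P? f (y ∷ʳ D⊆xs) PD = ≤-trans (sublist-sum-≤ P? f D⊆xs PD) (m≤n+m _ _)
sublist-sum-≤ P? f {x ∷ _} (refl ∷ D⊆xs) (Px ∷ PD) =
  +-mono-≤ (≤-reflexive (sym (if-yes (P? x) Px))) (sublist-sum-≤ P? f D⊆xs PD)

divSum-restrict : ∀ f {n M} → 1 ≤ n → M ∣ n → 1 ≤ M → divSum (λ d → [ d ∣? M ]· f d) n ≡ divSum f M
divSum-restrict f {n} {M} 1≤n M∣n 1≤M = begin
  sumTo (λ d → [ d ∣? n ]· ([ d ∣? M ]· f d)) n ≡⟨ sumTo-cong n (λ d _ _ → divisor-of-M d (d ∣? n) (d ∣? M)) ⟩
  sumTo (λ d → [ d ∣? M ]· f d) n               ≡⟨ sumTo-trunc M n (∣⇒≤ {{>-nonZero 1≤n}} M∣n)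
                                                     (λ k M<k → if-no (k ∣? M) (λ k∣M → <⇒≱ M<k (∣⇒≤ {{>-nonZero 1≤M}} k∣M))) ⟩
  sumTo (λ d → [ d ∣? M ]· f d) M ∎
  where
  open ≡-Reasoning
  divisor-of-M : ∀ d (e : Dec (d ∣ n)) (e′ : Dec (d ∣ M)) → [ e ]· ([ e′ ]· f d) ≡ [ e′ ]· f d
  divisor-of-M d (yes _) _ = refl
  divisor-of-M d (no d∤n) e′ = sym (if-no e′ (λ d∣M → d∤n (∣-trans d∣M M∣n)))

φ-≥-prime-factor : ∀ {x q} → Squarefree x → Prime q → q ∣ x → pred q ≤ φ x
φ-≥-prime-factor {q = zero} _ pr = contradiction (prime≥2 pr) λ ()
φ-≥-prime-factor {q = suc k} sf pr (divides x′ refl) = begin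
  k              ≡⟨ sym (*-identityʳ k) ⟩
  k * 1          ≤⟨ *-monoʳ-≤ k (φ-pos x′ (sqf-nonzero (sqf-∣ sf (∣m⇒∣m*n (suc k) ∣-refl)))) ⟩
  k * φ x′       ≡⟨ sym (φ-prime-mult pr (sqf-cofactor sf′ pr)) ⟩
  φ (suc k * x′) ≡⟨ cong φ (*-comm (suc k) x′) ⟩
  φ (x′ * suc k) ∎
  where
  open ≤-Reasoning
  sf′ : Squarefree (suc k * x′)
  sf′ = subst Squarefree (*-comm x′ (suc k)) sf

-- if p ∣ n and p > m + 2 for m = radBelow n p, then m + 1 is not a φ-sum over
-- divisors of n: summands with a prime factor ≥ p exceed m + 1, and the others
-- divide m, so they add up to at most Σ_{d ∣ m} φ(d) = m
gap : ∀ {n p D} → Squarefree n → Prime p → p ∣ n → radBelow n p + 2 < p →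
  D ⊆ divisors n → sum (map φ D) ≢ suc (radBelow n p)
gap {n} {p} {D} sf pr p∣n m+2<p D⊆ sumD = <-irrefl refl (begin
  suc M                                            ≡⟨ sym sumD ⟩
  sum (map φ D)                                    ≤⟨ sublist-sum-≤ (_∣? M) φ D⊆ D∣M ⟩
  sum (map (λ d → [ d ∣? M ]· φ d) (divisors n))   ≡⟨ divisors-sum _ n ⟩
  divSum (λ d → [ d ∣? M ]· φ d) n                 ≡⟨ divSum-restrict φ (sqf-nonzero sf) M∣n (radBelow-pos n p) ⟩
  divSum φ M                                       ≡⟨ gauss n p ⟩
  M ∎)
  where
  open ≤-Reasoning
  M = radBelow n p
  M∣n = radBelow-∣ n p
  divides-M : ∀ {x} → x ∣ n × φ x ≤ sum (map φ D) → x ∣ M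
  divides-M {x} (x∣n , φx≤) with smooth-or-large p x (sqf-∣ sf x∣n) x∣n
  ... | inj₁ x∣M = x∣M
  ... | inj₂ (q , prq , q∣x , p≤q) = contradiction φx≤ (<⇒≱ (begin-strict
    sum (map φ D) ≡⟨ sumD ⟩
    suc M         <⟨ ≤-refl ⟩
    suc (suc M)   ≡⟨ +-comm 2 M ⟩
    M + 2         ≤⟨ pred-mono-≤ m+2<p ⟩
    pred p        ≤⟨ pred-mono-≤ p≤q ⟩
    pred q        ≤⟨ φ-≥-prime-factor (sqf-∣ sf x∣n) prq q∣x ⟩
    φ x ∎))
  D∣M : All (_∣ M) D
  D∣M = All.zipWith divides-M (All-resp-⊆ D⊆ (all-filter (_∣? n) (range1 n)) , summand-≤ φ D)

forward : ∀ {n} → Squarefree n → φPractical n → weaklyφPractical n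
forward {n} sf practical p pr p∣n = subst (λ x → p ≤ x + 2) (sym (partBelow≡radBelow sf p)) (≮⇒≥ no-gap)
  where
  M = radBelow n p
  -- M is a proper divisor of n, as p divides n but not M
  M<n : M < n
  M<n = ≤∧≢⇒< (∣⇒≤ {{>-nonZero (sqf-nonzero sf)}} (radBelow-∣ n p))
               (λ M≡n → radBelow-coprime n pr (subst (p ∣_) (sym M≡n) p∣n))
  no-gap : ¬ M + 2 < p
  no-gap M+2<p with practical (suc M) (s≤s z≤n) M<n
  ... | D , D⊆ , sumD = gap sf pr p∣n M+2<p D⊆ sumD

corollary4p2 : (n : ℕ) → 1 ≤ n → Squarefree n →
    (φPractical n → weaklyφPractical n) × (weaklyφPractical n → φPractical n)
corollary4p2 n _ sf = forward sf , backward sf
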